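{- Let $H$ be a hedge graph whose hedge intersection graph $\mathcal{F}$ is acyclic, and let $U$ be a solution for \textsc{Hedge Cluster Deletion} on $H$. Let $Z$ be the set of hedges that span an internal $P_3$ in $H$ and let $X_{P,\triangle}$ be the set of all mixed vertices of $\mathcal{F}$. Then $Z\cup X_{P,\triangle}\subseteq U$.
   Context: A hedge graph $H$ is a simple graph whose edge set is partitioned into classes called hedges; $E_x$ denotes the edge set of hedge $x$. A solution for \textsc{Hedge Cluster Deletion} is a set $U$ of hedges such that after deleting all edges of hedges in $U$ every connected component is a clique. A hedge spans an internal $P_3$ if some induced path $a,b,c$ ($\{a,c\}\notin E(H)$) has both edges in that hedge. The hedge intersection graph $\mathcal{F}$ has the hedges as vertices, two distinct hedges adjacent iff they contain edges sharing an endpoint. Two hedges $x,y$ span a $P_3$ if there are edges $\{a,b\}\in E_x$, $\{b,c\}\in E_y$ with $\{a,c\}\notin E(H)$; they span a $K_3$ if there are $\{a,b\}\in E_x$, $\{b,c\}\in E_y$ with $\{a,c\}\in E_x\cup E_y$. $E_{P,\triangle}$ is the set of edges $\{x,y\}$ of $\mathcal{F}$ such that $x,y$ span both a $P_3$ and a $K_3$. For a hedge $x$, $SK_3(x)$ is the set of triangles with exactly one edge in $E_x$ and the other two edges in a single other hedge, and $D(x)$ is the set of hedges $y\ne x$ containing the other two edges of some triangle in $SK_3(x)$. A vertex $x$ of $\mathcal{F}$ is mixed if it is incident to an edge $\{x,y\}\in E_{P,\triangle}$ with $x\in D(y)$. -}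

module Defs where

open import Data.Nat using (ℕ; _≤_)
open import Data.Fin using (Fin)
open import Data.Fin.Subset using (Subset; _∈_; _∉_)
open import Data.Maybe using (Maybe; just; nothing)
open import Data.List using (List; []; _∷_; _++_; [_]; length)
open import Data.List.Relation.Unary.Linked using (Linked)
open import Data.List.Relation.Unary.Unique.Propositional using (Unique)
open import Data.Product using (Σ; ∃; ∃-syntax; _×_)
open import Data.Sum using (_⊎_)
open import Data.Empty using (⊥)
open import Relation.Nullary using (¬_)
open import Relation.Binary.PropositionalEquality using (_≡_; _≢_)

-- A hedge graph on vertex set Fin n with k hedges (hedge labels Fin k).
-- hedge a b ≡ just x  means {a,b} is an edge of H and it belongs to hedge x;
-- hedge a b ≡ nothing means {a,b} is not an edge.  Every edge lies in exactly
-- one hedge, so the hedges partition the edge set.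
record HedgeGraph (n k : ℕ) : Set where
  field
    hedge  : Fin n → Fin n → Maybe (Fin k)
    sym    : ∀ a b → hedge a b ≡ hedge b a
    irrefl : ∀ a → hedge a a ≡ nothing

module _ {n k : ℕ} (H : HedgeGraph n k) where
  open HedgeGraph H

  InHedge : Fin k → Fin n → Fin n → Set
  InHedge x a b = hedge a b ≡ just x

  Edge : Fin n → Fin n → Set
  Edge a b = ∃[ x ] InHedge x a b

  RemEdge : Subset k → Fin n → Fin n → Set
  RemEdge U a b = ∃[ x ] (InHedge x a b × x ∉ U)

  data Reach (U : Subset k) (a : Fin n) : Fin n → Set where
    here : Reach U a a
    step : ∀ {b c} → Reach U a b → RemEdge U b c → Reach U a c

  -- U is a solution of Hedge Cluster Deletion: every connected component
  -- of H − ⋃_{x∈U} E_x is a clique.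
  Solution : Subset k → Set
  Solution U = ∀ a c → Reach U a c → a ≢ c → RemEdge U a c

  FAdj : Fin k → Fin k → Set
  FAdj x y = x ≢ y × ∃[ a ] ∃[ b ] ∃[ c ] (InHedge x a b × InHedge y b c)

  Cycle : List (Fin k) → Set
  Cycle [] = ⊥
  Cycle (x₀ ∷ rest) =
    2 ≤ length rest × Unique (x₀ ∷ rest) × Linked FAdj (x₀ ∷ rest ++ [ x₀ ])

  Acyclic : Set
  Acyclic = ∀ xs → ¬ Cycle xs

  InternalP3 : Fin k → Set
  InternalP3 x = ∃[ a ] ∃[ b ] ∃[ c ]
    (InHedge x a b × InHedge x b c × a ≢ c × ¬ Edge a c)

  SpanP3 : Fin k → Fin k → Set
  SpanP3 x y = ∃[ a ] ∃[ b ] ∃[ c ]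
    (InHedge x a b × InHedge y b c × a ≢ c × ¬ Edge a c)

  SpanK3 : Fin k → Fin k → Set
  SpanK3 x y = ∃[ a ] ∃[ b ] ∃[ c ]
    (InHedge x a b × InHedge y b c × (InHedge x a c ⊎ InHedge y a c))

  EPT : Fin k → Fin k → Set
  EPT x y = FAdj x y × SpanP3 x y × SpanK3 x y

  -- y ∈ D(x): y ≠ x and some triangle has one edge in E_x and the
  -- other two edges in E_y (then exactly one edge lies in E_x)
  InD : Fin k → Fin k → Set
  InD y x = y ≢ x × ∃[ a ] ∃[ b ] ∃[ c ]
    (InHedge x a b × InHedge y b c × InHedge y a c)

  Mixed : Fin k → Set
  Mixed x = ∃[ y ] (EPT x y × InD x y)

{-# OPTIONS --safe #-}
-- In H minus the hedges of a solution U every component is a clique, so two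
-- surviving edges ab, bc with a ≠ c force ac to be a surviving edge. Hence no
-- P₃ has both of its hedges outside U. If a mixed vertex x were outside U,
-- the two x-edges of a triangle witnessing x ∈ D(y) would force its y-edge to
-- survive, so y ∉ U as well; but x and y span a P₃.
module Submission where

open import Defs
open import Data.Nat using (ℕ)
open import Data.Fin using (Fin)
open import Data.Fin.Subset using (Subset; _∈_; _∉_)
open import Data.Fin.Subset.Properties using (_∈?_)
open import Data.Sum using (_⊎_; inj₁; inj₂)
open import Data.Product using (_,_)
open import Data.Empty using (⊥)
open import Relation.Nullary.Decidable using (decidable-stable)
open import Relation.Binary.PropositionalEquality using (_≡_; _≢_; refl; sym; trans)

module _ {n k : ℕ} (H : HedgeGraph n k) where

  InHedge-sym : ∀ {x a b} → InHedge H x a b → InHedge H x b a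
  InHedge-sym {a = a} {b} e = trans (HedgeGraph.sym H b a) e

  InHedge⇒≢ : ∀ {x a b} → InHedge H x a b → a ≢ b
  InHedge⇒≢ {a = a} e refl with trans (sym (HedgeGraph.irrefl H a)) e
  ... | ()

  InHedge-functional : ∀ {x y a b} → InHedge H x a b → InHedge H y a b → x ≡ y
  InHedge-functional e f with trans (sym e) f
  ... | refl = refl

  module _ {U : Subset k} (sol : Solution H U) where

    Solution⇒RemEdge-trans : ∀ {a b c} →
      RemEdge H U a b → RemEdge H U b c → a ≢ c → RemEdge H U a c
    Solution⇒RemEdge-trans ab bc = sol _ _ (step (step here ab) bc)

    SpanP3⇒¬both-∉ : ∀ {x y} → SpanP3 H x y → x ∉ U → y ∉ U → ⊥
    SpanP3⇒¬both-∉ (a , b , c , ab , bc , a≢c , ¬ac) x∉U y∉U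
      with Solution⇒RemEdge-trans (_ , ab , x∉U) (_ , bc , y∉U) a≢c
    ... | z , ac , _ = ¬ac (z , ac)

    InD⇒∉ : ∀ {x y} → InD H x y → x ∉ U → y ∉ U
    InD⇒∉ (_ , a , b , c , ab , bc , ac) x∉U y∈U
      with Solution⇒RemEdge-trans (_ , ac , x∉U) (_ , InHedge-sym bc , x∉U)
                                  (InHedge⇒≢ ab)
    ... | z , ab′ , z∉U with InHedge-functional ab ab′
    ... | refl = z∉U y∈U

lemma6p1 : (n k : ℕ) (H : HedgeGraph n k) → Acyclic H →
    (U : Subset k) → Solution H U →
    (x : Fin k) → InternalP3 H x ⊎ Mixed H x → x ∈ U
lemma6p1 n k H _ U sol x p = decidable-stable (x ∈? U) (∉⇒⊥ p)
  where
  ∉⇒⊥ : InternalP3 H x ⊎ Mixed H x → x ∉ U → ⊥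
  ∉⇒⊥ (inj₁ xx-P3) x∉U = SpanP3⇒¬both-∉ H sol xx-P3 x∉U x∉U
  ∉⇒⊥ (inj₂ (y , (_ , xy-P3 , _) , x∈Dy)) x∉U =
    SpanP3⇒¬both-∉ H sol xy-P3 x∉U (InD⇒∉ H sol x∈Dy x∉U)
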